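{- Let $\mathcal G$ be a hypergraph, $\alpha\in V(\mathcal G)$, $n$ a positive integer, and let $\mathcal F$ be an $(\alpha,n)$-detachment of $\mathcal G$ such that $c(\mathcal F)=c(\mathcal G)$. Then $\deg_{\mathcal G}(\alpha)-\omega_\alpha(\mathcal G)\geq n-1$.
   Context: Hypergraphs have a finite vertex set and a finite multiset of edges, each edge a nonempty multiset of vertices; $\deg(v)$ counts all occurrences of $v$ in edges; $c(\cdot)$ is the number of connected components (isolated vertices count). An $(\alpha,n)$-detachment of $\mathcal G$ is obtained by replacing $\alpha$ by new vertices $\alpha_1,\dots,\alpha_n$ and each edge $\{\alpha^p\}\cup U$ ($p\ge1$, $U$ not containing $\alpha$) by $\{\alpha_1^{p_1},\dots,\alpha_n^{p_n}\}\cup U$ with $p_1+\dots+p_n=p$; other edges unchanged. A vertex $\alpha$ of a connected hypergraph is a cut vertex if there are non-trivial (having at least one edge) sub-hypergraphs $I,J$ with $I\cup J$ the whole hypergraph, $V(I\cap J)=\{\alpha\}$, $E(I\cap J)=\varnothing$. A sub-hypergraph $W$ with $\alpha\in V(W)$ is an $\alpha$-wing of $\mathcal G$ if $W$ is non-trivial and connected, $\alpha$ is not a cut vertex of $W$, and no edge of $E(\mathcal G)\setminus E(W)$ contains a vertex of $V(W)\setminus\{\alpha\}$. $\omega_\alpha(\mathcal G)$ is the number of $\alpha$-wings of $\mathcal G$. -}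

module Defs where

open import Data.Nat using (ℕ; zero; suc; _+_; _<_)
open import Data.Fin using (Fin; zero; suc; punchIn; _↑ˡ_; _↑ʳ_)
open import Data.Fin.Subset using (Subset; _∈_; _∉_; _∪_; _∩_; ⁅_⁆; ⊤) renaming (⊥ to ∅)
open import Data.Product using (Σ; ∃; _×_; _,_)
open import Data.List using (List; length)
open import Data.List.Relation.Unary.All using (All)
open import Data.List.Relation.Unary.Unique.Propositional using (Unique)
import Data.List.Membership.Propositional as LM
open import Relation.Binary.PropositionalEquality using (_≡_; _≢_)
open import Relation.Nullary using (¬_)
open import Function.Bundles using (_⤖_; Bijection)

sumFin : ∀ {k} → (Fin k → ℕ) → ℕ
sumFin {zero}  f = 0
sumFin {suc k} f = f zero + sumFin (λ i → f (suc i))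

-- A hypergraph on vertex set Fin m with a finite family (multiset) of nE edges,
-- edge e being the multiset of vertices given by the multiplicity function inc e.
record Hypergraph (m : ℕ) : Set where
  field
    nE       : ℕ
    inc      : Fin nE → Fin m → ℕ
    nonempty : ∀ e → ∃ λ v → 0 < inc e v
open Hypergraph public

deg : ∀ {m} (G : Hypergraph m) → Fin m → ℕ
deg G v = sumFin (λ e → inc G e v)

SubH : ∀ {m} → Hypergraph m → Set
SubH {m} G = Subset m × Subset (nE G)

module _ {m : ℕ} (G : Hypergraph m) where

  data Path (SE : Subset (nE G)) : Fin m → Fin m → Set where
    here : ∀ {v} → Path SE v v
    step : ∀ {u w v} (e : Fin (nE G)) → e ∈ SE → 0 < inc G e u → 0 < inc G e w →
           Path SE w v → Path SE u v

  IsSub : SubH G → Set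
  IsSub (SV , SE) = ∀ e v → e ∈ SE → 0 < inc G e v → v ∈ SV

  NonTrivial : SubH G → Set
  NonTrivial (SV , SE) = ∃ λ e → e ∈ SE

  ConnectedSub : SubH G → Set
  ConnectedSub (SV , SE) = ∀ u v → u ∈ SV → v ∈ SV → Path SE u v

  CutVertex : SubH G → Fin m → Set
  CutVertex (SV , SE) α =
    Σ (SubH G) λ { (SVI , SEI) → Σ (SubH G) λ { (SVJ , SEJ) →
      IsSub (SVI , SEI) × IsSub (SVJ , SEJ) ×
      NonTrivial (SVI , SEI) × NonTrivial (SVJ , SEJ) ×
      (SVI ∪ SVJ ≡ SV) × (SEI ∪ SEJ ≡ SE) ×
      (SVI ∩ SVJ ≡ ⁅ α ⁆) × (SEI ∩ SEJ ≡ ∅) } }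

  IsWing : Fin m → SubH G → Set
  IsWing α (SV , SE) =
    α ∈ SV × IsSub (SV , SE) × NonTrivial (SV , SE) × ConnectedSub (SV , SE) ×
    ¬ CutVertex (SV , SE) α ×
    (∀ e v → e ∉ SE → v ∈ SV → v ≢ α → inc G e v ≡ 0)

  -- ω_α(G) = k : ws lists all α-wings, each exactly once
  WingCount : Fin m → ℕ → Set
  WingCount α k = Σ (List (SubH G)) λ ws →
    Unique ws × All (IsWing α) ws × (∀ w → IsWing α w → w LM.∈ ws) × length ws ≡ k

  -- c(G) = k : f labels vertices by components, onto Fin k
  Components : ℕ → Set
  Components k = Σ (Fin m → Fin k) λ f →
    (∀ c → ∃ λ v → f v ≡ c) ×
    (∀ u v → f u ≡ f v → Path ⊤ u v) × (∀ u v → Path ⊤ u v → f u ≡ f v)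

-- Vertices of G : Fin (suc m); vertices of F : Fin (m + n),
-- where i ↑ˡ n is the old vertex punchIn α i (≠ α) and m ↑ʳ j is the new vertex α_(j+1).
IsDetachment : ∀ {m} → Hypergraph (suc m) → Fin (suc m) → (n : ℕ) → Hypergraph (m + n) → Set
IsDetachment {m} G α n F = Σ (Fin (nE G) ⤖ Fin (nE F)) λ σ →
  (∀ e i → inc F (Bijection.to σ e) (i ↑ˡ n) ≡ inc G e (punchIn α i)) ×
  (∀ e → sumFin (λ j → inc F (Bijection.to σ e) (m ↑ʳ j)) ≡ inc G e α)

-- Every edge at α lies in exactly one α-wing.  Let B be the graph on the new vertices
-- α₁ … αₙ and the ω wings with an edge αⱼ — W for every edge of W whose image in F contains
-- αⱼ; it has at most deg(α) edges.  As c(F) = c(G), projecting F onto G induces a surjection,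
-- hence a bijection, between their components, so all αⱼ lie in one component of F.  A path
-- of F between them gives a walk in B, because it can only leave a wing through some αⱼ.
-- Every wing meets some αⱼ, so B is connected, and a connected graph on n + ω vertices has at
-- least n + ω − 1 edges.
module Submission where

open import Defs
open import Data.Nat using (ℕ; zero; suc; _+_; _∸_; _≤_; _<_; z≤n; s≤s; z<s; _<?_; s≤s⁻¹)
open import Data.Nat.Properties
  using (≤-refl; ≤-trans; <-≤-trans; m≤m+n; m≤n+m; +-mono-≤; +-monoʳ-≤; n≤1+n; +-suc; +-identityʳ; 1+n≰n; n≮0;
         module ≤-Reasoning)
open import Data.Fin using (Fin; zero; suc; _≟_; punchIn; punchOut; splitAt; _↑ˡ_; _↑ʳ_; fromℕ<)
open import Data.Fin.Properties
  using (punchOut-injective; punchOut-cong; punchOut-punchIn; punchIn-punchOut; punchInᵢ≢i; injective⇒≤; ¬Fin0; any?;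
         splitAt-↑ˡ; splitAt-↑ʳ; splitAt⁻¹-↑ˡ; splitAt⁻¹-↑ʳ; ↑ʳ-injective)
open import Data.Fin.Subset using (Subset; _∈_; _∉_; _∪_; _∩_; ⁅_⁆; ∁; _⊆_; ⊤) renaming (⊥ to ∅)
open import Data.Fin.Subset.Properties
  using (_∈?_; x∈p∪q⁺; x∈p∪q⁻; x∈p∩q⁺; x∈p∩q⁻; x∈⁅x⁆; x∈⁅y⁆⇒x≡y; x∈∁p⇒x∉p; x∉p⇒x∈∁p; ∉⊥; ⊥⊆; ∈⊤;
         ⊆-antisym; p⊆p∪q; p∩q⊆q; ∪-assoc; ∪-comm; ∪-identityˡ; ∪-inverseʳ; ∩-comm; ∩-identityʳ; ∩-distribˡ-∪)
open import Data.Vec using ([]; _∷_; here; there)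
open import Data.List using (List; []; _∷_; [_]; _++_; length; lookup; filter; cartesianProduct; allFin)
open import Data.List.Properties using (length-++)
import Data.List.Membership.Propositional as List
open import Data.List.Membership.Propositional.Properties
  using (∈-++⁺ˡ; ∈-++⁺ʳ; ∈-lookup; ∈-filter⁺; ∈-filter⁻; ∈-cartesianProduct⁺; ∈-allFin)
open import Data.List.Relation.Unary.All using (All)
import Data.List.Relation.Unary.All as All
open import Data.List.Relation.Unary.Any using (here; there)
import Data.List.Relation.Unary.Any as Any
open import Data.List.Relation.Unary.Any.Properties using (lookup-index)
open import Data.List.Relation.Unary.AllPairs using (_∷_)
open import Data.List.Relation.Unary.Unique.Propositional using (Unique)
open import Data.Product using (∃; _×_; _,_; proj₁; proj₂; uncurry)
import Data.Product as Product
open import Data.Sum using (_⊎_; inj₁; inj₂; [_,_]′)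
open import Data.Empty using (⊥-elim)
open import Function.Base using (_∘_; id; const)
open import Function.Bundles using (Bijection; Surjection)
open import Function.Definitions using (Injective; StrictlySurjective)
open import Level using (0ℓ)
open import Relation.Nullary using (¬_; yes; no; contradiction)
import Relation.Nullary.Decidable as Dec
open import Relation.Nullary.Decidable using (_×-dec_; _⊎-dec_; ¬?)
import Relation.Unary
open import Relation.Binary.Core using (Rel)
open import Relation.Binary.Definitions using (Decidable; Symmetric)
open import Relation.Binary.PropositionalEquality
  using (_≡_; _≢_; refl; sym; trans; cong; cong₂; subst; isEquivalence; module ≡-Reasoning)
open import Relation.Binary.Construct.Closure.Equivalence using (EqClosure; gfold; symmetric)
import Relation.Binary.Construct.Closure.Equivalence as EqClosure
open import Relation.Binary.Construct.Closure.ReflexiveTransitive using (ε; _◅_; _◅◅_)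
open import Relation.Binary.Construct.Closure.Symmetric using (fwd; bwd)
import Relation.Binary.Construct.Closure.Symmetric as SC

≤-sumFin : ∀ {k} (f : Fin k → ℕ) i → f i ≤ sumFin f
≤-sumFin f zero    = m≤m+n _ _
≤-sumFin f (suc i) = ≤-trans (≤-sumFin (f ∘ suc) i) (m≤n+m _ _)

sumFin-mono-≤ : ∀ {k} {f g : Fin k → ℕ} → (∀ i → f i ≤ g i) → sumFin f ≤ sumFin g
sumFin-mono-≤ {zero}  f≤g = z≤n
sumFin-mono-≤ {suc k} f≤g = +-mono-≤ (f≤g zero) (sumFin-mono-≤ (f≤g ∘ suc))

sumFin-positive : ∀ {k} (f : Fin k → ℕ) → 0 < sumFin f → ∃ λ i → 0 < f i
sumFin-positive {suc k} f 0<Σf with f zero in eq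
... | suc _ = zero , subst (0 <_) (sym eq) z<s
... | zero  = Product.map suc id (sumFin-positive (f ∘ suc) 0<Σf)

concatFin : ∀ {A : Set} {k} → (Fin k → List A) → List A
concatFin {k = zero}  xs = []
concatFin {k = suc k} xs = xs zero ++ concatFin (xs ∘ suc)

∈-concatFin⁺ : ∀ {A : Set} {k} (xs : Fin k → List A) {x} i → x List.∈ xs i → x List.∈ concatFin xs
∈-concatFin⁺ xs zero    x∈ = ∈-++⁺ˡ x∈
∈-concatFin⁺ xs (suc i) x∈ = ∈-++⁺ʳ (xs zero) (∈-concatFin⁺ (xs ∘ suc) i x∈)

length-concatFin : ∀ {A : Set} {k} (xs : Fin k → List A) → length (concatFin xs) ≡ sumFin (length ∘ xs)
length-concatFin {k = zero}  xs = refl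
length-concatFin {k = suc k} xs =
  trans (length-++ (xs zero)) (cong (length (xs zero) +_) (length-concatFin (xs ∘ suc)))

Unique-lookup-injective : ∀ {A : Set} {xs : List A} → Unique xs → Injective _≡_ _≡_ (lookup xs)
Unique-lookup-injective {xs = _ ∷ _} _ {zero} {zero} _ = refl
Unique-lookup-injective {xs = _ ∷ _} (x∉xs ∷ _) {zero} {suc j} eq =
  contradiction eq (All.lookup x∉xs (∈-lookup j))
Unique-lookup-injective {xs = _ ∷ _} (x∉xs ∷ _) {suc i} {zero} eq =
  contradiction (sym eq) (All.lookup x∉xs (∈-lookup i))
Unique-lookup-injective {xs = _ ∷ _} (_ ∷ xs-unique) {suc i} {suc j} eq =
  cong suc (Unique-lookup-injective xs-unique eq)

subsetOf : ∀ {n} {P : Fin n → Set} → Relation.Unary.Decidable P → Subset n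
subsetOf {zero}  P? = []
subsetOf {suc n} P? = Dec.does (P? zero) ∷ subsetOf (P? ∘ suc)

∈-subsetOf⁺ : ∀ {n} {P : Fin n → Set} (P? : Relation.Unary.Decidable P) {x} → P x → x ∈ subsetOf P?
∈-subsetOf⁺ P? {zero}  Px with P? zero
... | yes _  = here
... | no ¬Px = contradiction Px ¬Px
∈-subsetOf⁺ P? {suc x} Px = there (∈-subsetOf⁺ (P? ∘ suc) Px)

∈-subsetOf⁻ : ∀ {n} {P : Fin n → Set} (P? : Relation.Unary.Decidable P) {x} → x ∈ subsetOf P? → P x
∈-subsetOf⁻ P? {zero} x∈ with P? zero | x∈
... | yes Px | _ = Px
∈-subsetOf⁻ P? {suc x} (there x∈) = ∈-subsetOf⁻ (P? ∘ suc) x∈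

p∩q∪p∩∁q≡p : ∀ {n} (p q : Subset n) → p ∩ q ∪ p ∩ ∁ q ≡ p
p∩q∪p∩∁q≡p p q = begin
  p ∩ q ∪ p ∩ ∁ q ≡⟨ ∩-distribˡ-∪ p q (∁ q) ⟨
  p ∩ (q ∪ ∁ q)   ≡⟨ cong (p ∩_) (∪-inverseʳ q) ⟩
  p ∩ ⊤           ≡⟨ ∩-identityʳ p ⟩
  p               ∎
  where open ≡-Reasoning

p∩q∩p∩∁q≡⊥ : ∀ {n} (p q : Subset n) → (p ∩ q) ∩ (p ∩ ∁ q) ≡ ∅
p∩q∩p∩∁q≡⊥ p q = ⊆-antisym ⊆∅ ⊥⊆
  where
  ⊆∅ : (p ∩ q) ∩ (p ∩ ∁ q) ⊆ ∅
  ⊆∅ {x} x∈ with x∈p∩q⁻ (p ∩ q) (p ∩ ∁ q) x∈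
  ... | x∈p∩q , x∈p∩∁q = contradiction (proj₂ (x∈p∩q⁻ p q x∈p∩q)) (x∈∁p⇒x∉p (proj₂ (x∈p∩q⁻ p (∁ q) x∈p∩∁q)))

x∈p⇒p∪⁅x⁆≡p : ∀ {n} {p : Subset n} {x} → x ∈ p → p ∪ ⁅ x ⁆ ≡ p
x∈p⇒p∪⁅x⁆≡p {p = p} {x} x∈p = ⊆-antisym ⊆p (p⊆p∪q ⁅ x ⁆)
  where
  ⊆p : p ∪ ⁅ x ⁆ ⊆ p
  ⊆p y∈ with x∈p∪q⁻ p ⁅ x ⁆ y∈
  ... | inj₁ y∈p = y∈p
  ... | inj₂ y∈x rewrite x∈⁅y⁆⇒x≡y x y∈x = x∈p

x∈p⇒p∩⁅x⁆≡⁅x⁆ : ∀ {n} {p : Subset n} {x} → x ∈ p → p ∩ ⁅ x ⁆ ≡ ⁅ x ⁆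
x∈p⇒p∩⁅x⁆≡⁅x⁆ {p = p} {x} x∈p = ⊆-antisym (p∩q⊆q p ⁅ x ⁆) ⊇x
  where
  ⊇x : ⁅ x ⁆ ⊆ p ∩ ⁅ x ⁆
  ⊇x y∈x rewrite x∈⁅y⁆⇒x≡y x y∈x = x∈p∩q⁺ (x∈p , x∈⁅x⁆ x)

surjective⇒injective : ∀ {k} (h : Fin k → Fin k) → StrictlySurjective _≡_ h → Injective _≡_ _≡_ h
surjective⇒injective {suc k} h surj {x} {y} hx≡hy with x ≟ y
... | yes x≡y = x≡y
... | no  x≢y = contradiction (injective⇒≤ section-injective) 1+n≰n
  where
  -- Since y takes over x's value, h stays onto without x, so Fin (suc k) injects into Fin k.
  h-x : Fin k → Fin (suc k)
  h-x t = h (punchIn x t)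

  h-x-surjective : StrictlySurjective _≡_ h-x
  h-x-surjective t with surj t
  ... | z , hz≡t with z ≟ x
  ... | yes refl = punchOut x≢y , trans (cong h (punchIn-punchOut x≢y)) (trans (sym hx≡hy) hz≡t)
  ... | no  z≢x  = punchOut (z≢x ∘ sym) , trans (cong h (punchIn-punchOut (z≢x ∘ sym))) hz≡t

  section-injective : Injective _≡_ _≡_ (proj₁ ∘ h-x-surjective)
  section-injective {a} {b} eq =
    trans (sym (proj₂ (h-x-surjective a))) (trans (cong h-x eq) (proj₂ (h-x-surjective b)))

-- Graphs given by edge lists

module _ {N : ℕ} where

  Joins : List (Fin N × Fin N) → Rel (Fin N) _
  Joins ps x y = (x , y) List.∈ ps

  Reach : List (Fin N × Fin N) → Rel (Fin N) _
  Reach ps = EqClosure (Joins ps)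

  record ComponentLabelling (ps : List (Fin N × Fin N)) (c : ℕ) : Set where
    field
      label            : Fin N → Fin c
      label-surjective : StrictlySurjective _≡_ label
      label-sound      : ∀ {x y} → label x ≡ label y → Reach ps x y
      label-respects   : ∀ {x y} → Joins ps x y → label x ≡ label y
      size-bound       : N ≤ c + length ps

    label-complete : ∀ {x y} → Reach ps x y → label x ≡ label y
    label-complete = gfold isEquivalence label label-respects

  open ComponentLabelling

  module Identify {c : ℕ} {p q : Fin (suc c)} (p≢q : p ≢ q) where

    identify : Fin (suc c) → Fin c
    identify x with x ≟ q
    ... | yes _   = punchOut (p≢q ∘ sym)
    ... | no  x≢q = punchOut (x≢q ∘ sym)

    identify-p≡identify-q : identify p ≡ identify q
    identify-p≡identify-q with p ≟ q | q ≟ q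
    ... | yes p≡q | _       = contradiction p≡q p≢q
    ... | no  _   | yes _   = punchOut-cong q refl
    ... | no  _   | no  q≢q = contradiction refl q≢q

    identify-injective-except :
      ∀ {x y} → identify x ≡ identify y → x ≡ y ⊎ ((x ≡ p × y ≡ q) ⊎ (x ≡ q × y ≡ p))
    identify-injective-except {x} {y} eq with x ≟ q | y ≟ q
    ... | yes x≡q | yes y≡q = inj₁ (trans x≡q (sym y≡q))
    ... | yes x≡q | no  y≢q = inj₂ (inj₂ (x≡q , sym (punchOut-injective (p≢q ∘ sym) (y≢q ∘ sym) eq)))
    ... | no  x≢q | yes y≡q = inj₂ (inj₁ (punchOut-injective (x≢q ∘ sym) (p≢q ∘ sym) eq , y≡q))
    ... | no  x≢q | no  y≢q = inj₁ (punchOut-injective (x≢q ∘ sym) (y≢q ∘ sym) eq)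

    identify-punchIn : ∀ t → identify (punchIn q t) ≡ t
    identify-punchIn t with punchIn q t ≟ q
    ... | yes eq = contradiction eq (punchInᵢ≢i q t)
    ... | no  _  = trans (punchOut-cong q refl) (punchOut-punchIn q)

  merge : ∀ {ps a b c} (L : ComponentLabelling ps (suc c)) → label L a ≢ label L b →
          ComponentLabelling ((a , b) ∷ ps) c
  merge {ps} {a} {b} {c} L different = record
    { label            = identify ∘ label L
    ; label-surjective = surjective
    ; label-sound      = sound
    ; label-respects   = λ { (here refl) → identify-p≡identify-q
                           ; (there j)   → cong identify (label-respects L j) }
    ; size-bound       = subst (N ≤_) (sym (+-suc c (length ps))) (size-bound L)
    }
    where
    open Identify different

    surjective : StrictlySurjective _≡_ (identify ∘ label L)
    surjective t with label-surjective L (punchIn (label L b) t)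
    ... | x , x↦ = x , trans (cong identify x↦) (identify-punchIn t)

    extend : ∀ {x y} → Reach ps x y → Reach ((a , b) ∷ ps) x y
    extend = EqClosure.map there

    sound : ∀ {x y} → identify (label L x) ≡ identify (label L y) → Reach ((a , b) ∷ ps) x y
    sound eq with identify-injective-except eq
    ... | inj₁ same                = extend (label-sound L same)
    ... | inj₂ (inj₁ (x~a , y~b)) = extend (label-sound L x~a) ◅◅ fwd (here refl) ◅ extend (label-sound L (sym y~b))
    ... | inj₂ (inj₂ (x~b , y~a)) = extend (label-sound L x~b) ◅◅ bwd (here refl) ◅ extend (label-sound L (sym y~a))

  add-edge : ∀ {ps a b c} → ComponentLabelling ps c → ∃ (ComponentLabelling ((a , b) ∷ ps))
  add-edge {ps} {a} {b} {c} L with label L a ≟ label L b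
  ... | yes same = c , record
    { label            = label L
    ; label-surjective = label-surjective L
    ; label-sound      = EqClosure.map there ∘ label-sound L
    ; label-respects   = λ { (here refl) → same ; (there j) → label-respects L j }
    ; size-bound       = ≤-trans (size-bound L) (+-monoʳ-≤ c (n≤1+n _))
    }
  add-edge {a = a} {c = zero} L | no _ = ⊥-elim (¬Fin0 (label L a))
  add-edge {c = suc c} L | no different = c , merge L different

  componentLabelling : ∀ ps → ∃ (ComponentLabelling ps)
  componentLabelling []            = N , record
    { label            = id
    ; label-surjective = λ t → t , refl
    ; label-sound      = λ { refl → ε }
    ; label-respects   = λ ()
    ; size-bound       = subst (N ≤_) (sym (+-identityʳ N)) ≤-refl
    }
  componentLabelling (_ ∷ ps) = add-edge (proj₂ (componentLabelling ps))

  connected⇒≤1+length : ∀ ps → (∀ x y → Reach ps x y) → N ≤ suc (length ps)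
  connected⇒≤1+length ps connected with componentLabelling ps
  ... | zero , L           = ≤-trans (size-bound L) (n≤1+n _)
  ... | suc zero , L       = size-bound L
  ... | suc (suc c) , L with label-surjective L zero | label-surjective L (suc zero)
  ... | x , x↦0 | y , y↦1 with trans (sym x↦0) (trans (label-complete L (connected x y)) y↦1)
  ... | ()

  module _ {R : Rel (Fin N) 0ℓ} (R? : Decidable R) where

    private
      allPairs : List (Fin N × Fin N)
      allPairs = cartesianProduct (allFin N) (allFin N)

      edgesOf : List (Fin N × Fin N)
      edgesOf = filter (uncurry R?) allPairs

      toReach : ∀ {x y} → EqClosure R x y → Reach edgesOf x y
      toReach = EqClosure.map λ {x} {y} → ∈-filter⁺ (uncurry R?) (∈-cartesianProduct⁺ (∈-allFin x) (∈-allFin y))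

      fromReach : ∀ {x y} → Reach edgesOf x y → EqClosure R x y
      fromReach = EqClosure.map (proj₂ ∘ ∈-filter⁻ (uncurry R?) {xs = allPairs})

    EqClosure-decidable : Decidable (EqClosure R)
    EqClosure-decidable x y with componentLabelling edgesOf
    ... | _ , L = Dec.map′ (fromReach ∘ label-sound L) (label-complete L ∘ toReach) (label L x ≟ label L y)


-- Paths and wings

module _ {m : ℕ} {G : Hypergraph m} where

  Path-trans : ∀ {SE u v w} → Path G SE u v → Path G SE v w → Path G SE u w
  Path-trans here                      q = q
  Path-trans (step e e∈ u∈e w∈e p) q = step e e∈ u∈e w∈e (Path-trans p q)

  Path-sym : ∀ {SE u v} → Path G SE u v → Path G SE v u
  Path-sym p = reverse-onto p here
    where
    reverse-onto : ∀ {SE u v x} → Path G SE u v → Path G SE u x → Path G SE v x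
    reverse-onto here                    acc = acc
    reverse-onto (step e e∈ u∈e w∈e p) acc = reverse-onto p (step e e∈ w∈e u∈e acc)

  Path-mono : ∀ {SE SE′ u v} → SE ⊆ SE′ → Path G SE u v → Path G SE′ u v
  Path-mono SE⊆SE′ here                    = here
  Path-mono SE⊆SE′ (step e e∈ u∈e w∈e p) = step e (SE⊆SE′ e∈) u∈e w∈e (Path-mono SE⊆SE′ p)

  Path-closed : ∀ {SV SE u v} → IsSub G (SV , SE) → Path G SE u v → u ∈ SV → v ∈ SV
  Path-closed sub here                    u∈ = u∈
  Path-closed sub (step e e∈ u∈e w∈e p) u∈ = Path-closed sub p (sub e _ e∈ w∈e)

module _ {m : ℕ} {G : Hypergraph m} {α : Fin m} where

  wing-edge-at-α : ∀ {W} → IsWing G α W → ∃ λ e → e ∈ proj₂ W × 0 < inc G e α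
  wing-edge-at-α (α∈ , sub , (e , e∈) , connected , _) with nonempty G e
  ... | v , v∈e with connected α v α∈ (sub e v e∈ v∈e)
  ... | here                   = e , e∈ , v∈e
  ... | step e′ e′∈ α∈e′ _ _ = e′ , e′∈ , α∈e′

  module _ {W : SubH G} (W-wing : IsWing G α W) where

    wing-∋α : α ∈ proj₁ W
    wing-∋α = proj₁ W-wing

    wing-isSub : IsSub G W
    wing-isSub = proj₁ (proj₂ W-wing)

    wing-connected : ConnectedSub G W
    wing-connected = proj₁ (proj₂ (proj₂ (proj₂ W-wing)))

    wing-noCut : ¬ CutVertex G W α
    wing-noCut = proj₁ (proj₂ (proj₂ (proj₂ (proj₂ W-wing))))

    wing-closed : ∀ e v → e ∉ proj₂ W → v ∈ proj₁ W → v ≢ α → inc G e v ≡ 0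
    wing-closed = proj₂ (proj₂ (proj₂ (proj₂ (proj₂ W-wing))))

  module Overlap {SV₁ SV₂ : Subset m} {SE₁ SE₂ : Subset (nE G)}
                 (W₁ : IsWing G α (SV₁ , SE₁)) (W₂ : IsWing G α (SV₂ , SE₂)) where

    open ≡-Reasoning

    I J : SubH G
    I = SV₁ ∩ SV₂ , SE₁ ∩ SE₂
    J = (SV₁ ∩ ∁ SV₂) ∪ ⁅ α ⁆ , SE₁ ∩ ∁ SE₂

    sub-I : IsSub G I
    sub-I f v f∈ v∈f with x∈p∩q⁻ SE₁ SE₂ f∈
    ... | f∈₁ , f∈₂ = x∈p∩q⁺ (wing-isSub W₁ f v f∈₁ v∈f , wing-isSub W₂ f v f∈₂ v∈f)

    sub-J : IsSub G J
    sub-J f v f∈ v∈f with x∈p∩q⁻ SE₁ (∁ SE₂) f∈ | v ≟ α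
    ... | _ , _ | yes refl = x∈p∪q⁺ (inj₂ (x∈⁅x⁆ α))
    ... | f∈₁ , f∉₂ | no v≢α with v ∈? SV₂
    ...   | yes v∈₂ = ⊥-elim (n≮0 (subst (0 <_) (wing-closed W₂ f v (x∈∁p⇒x∉p f∉₂) v∈₂ v≢α) v∈f))
    ...   | no  v∉₂ = x∈p∪q⁺ (inj₁ (x∈p∩q⁺ (wing-isSub W₁ f v f∈₁ v∈f , x∉p⇒x∈∁p v∉₂)))

    ∪-V : proj₁ I ∪ proj₁ J ≡ SV₁
    ∪-V = begin
      SV₁ ∩ SV₂ ∪ (SV₁ ∩ ∁ SV₂ ∪ ⁅ α ⁆) ≡⟨ ∪-assoc (SV₁ ∩ SV₂) _ _ ⟨
      (SV₁ ∩ SV₂ ∪ SV₁ ∩ ∁ SV₂) ∪ ⁅ α ⁆ ≡⟨ cong (_∪ ⁅ α ⁆) (p∩q∪p∩∁q≡p SV₁ SV₂) ⟩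
      SV₁ ∪ ⁅ α ⁆                       ≡⟨ x∈p⇒p∪⁅x⁆≡p (wing-∋α W₁) ⟩
      SV₁                               ∎

    ∪-E : proj₂ I ∪ proj₂ J ≡ SE₁
    ∪-E = p∩q∪p∩∁q≡p SE₁ SE₂

    ∩-V : proj₁ I ∩ proj₁ J ≡ ⁅ α ⁆
    ∩-V = begin
      (SV₁ ∩ SV₂) ∩ (SV₁ ∩ ∁ SV₂ ∪ ⁅ α ⁆)               ≡⟨ ∩-distribˡ-∪ (SV₁ ∩ SV₂) _ _ ⟩
      (SV₁ ∩ SV₂) ∩ (SV₁ ∩ ∁ SV₂) ∪ (SV₁ ∩ SV₂) ∩ ⁅ α ⁆ ≡⟨ cong₂ _∪_ (p∩q∩p∩∁q≡⊥ SV₁ SV₂)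
                                                             (x∈p⇒p∩⁅x⁆≡⁅x⁆ (x∈p∩q⁺ (wing-∋α W₁ , wing-∋α W₂))) ⟩
      ∅ ∪ ⁅ α ⁆                                           ≡⟨ ∪-identityˡ ⁅ α ⁆ ⟩
      ⁅ α ⁆                                               ∎

    ∩-E : proj₂ I ∩ proj₂ J ≡ ∅
    ∩-E = p∩q∩p∩∁q≡⊥ SE₁ SE₂

  -- Otherwise W₁ ∩ W₂ and (W₁ ∖ W₂) ∪ {α} would split W₁ at α.
  wing-⊆ : ∀ {W₁ W₂ e} → IsWing G α W₁ → IsWing G α W₂ → e ∈ proj₂ W₁ → e ∈ proj₂ W₂ →
           proj₂ W₁ ⊆ proj₂ W₂
  wing-⊆ {SV₁ , SE₁} {SV₂ , SE₂} {e} W₁ W₂ e∈₁ e∈₂ {x} x∈₁ with x ∈? SE₂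
  ... | yes x∈₂ = x∈₂
  ... | no  x∉₂ = ⊥-elim (wing-noCut W₁ (I , J , sub-I , sub-J , (e , x∈p∩q⁺ (e∈₁ , e∈₂)) ,
                                         (x , x∈p∩q⁺ (x∈₁ , x∉p⇒x∈∁p x∉₂)) , ∪-V , ∪-E , ∩-V , ∩-E))
    where open Overlap W₁ W₂

  wings-sharing-edge-≡ : ∀ {W₁ W₂ e} → IsWing G α W₁ → IsWing G α W₂ → e ∈ proj₂ W₁ → e ∈ proj₂ W₂ → W₁ ≡ W₂
  wings-sharing-edge-≡ {SV₁ , SE₁} {SV₂ , SE₂} W₁ W₂ e∈₁ e∈₂ =
    cong₂ _,_ (⊆-antisym (vertices-⊆ W₁ W₂ SE₁⊆SE₂) (vertices-⊆ W₂ W₁ SE₂⊆SE₁)) (⊆-antisym SE₁⊆SE₂ SE₂⊆SE₁)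
    where
    SE₁⊆SE₂ = wing-⊆ W₁ W₂ e∈₁ e∈₂
    SE₂⊆SE₁ = wing-⊆ W₂ W₁ e∈₂ e∈₁
    vertices-⊆ : ∀ {U V} → IsWing G α U → IsWing G α V → proj₂ U ⊆ proj₂ V → proj₁ U ⊆ proj₁ V
    vertices-⊆ U-wing V-wing U⊆V {v} v∈U = Path-closed (wing-isSub V-wing)
      (Path-mono U⊆V (wing-connected U-wing α v (wing-∋α U-wing) v∈U)) (wing-∋α V-wing)

  Adjacent : Rel (Fin (nE G)) 0ℓ
  Adjacent e f = ∃ λ v → v ≢ α × 0 < inc G e v × 0 < inc G f v

  Adjacent? : Decidable Adjacent
  Adjacent? e f = any? λ v → ¬? (v ≟ α) ×-dec 0 <? inc G e v ×-dec 0 <? inc G f v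

  Adjacent-sym : Symmetric Adjacent
  Adjacent-sym (v , v≢α , v∈e , v∈f) = v , v≢α , v∈f , v∈e

  Linked : Rel (Fin (nE G)) 0ℓ
  Linked = EqClosure Adjacent

  Linked? : Decidable Linked
  Linked? = EqClosure-decidable Adjacent?

  module WingThrough (e₀ : Fin (nE G)) (α∈e₀ : 0 < inc G e₀ α) where

    SE : Subset (nE G)
    SE = subsetOf (Linked? e₀)

    SV : Subset m
    SV = subsetOf λ v → v ≟ α ⊎-dec any? λ e → Linked? e₀ e ×-dec 0 <? inc G e v

    linked⇒∈SE : ∀ {e} → Linked e₀ e → e ∈ SE
    linked⇒∈SE = ∈-subsetOf⁺ (Linked? e₀)

    ∈SE⇒linked : ∀ {e} → e ∈ SE → Linked e₀ e
    ∈SE⇒linked = ∈-subsetOf⁻ (Linked? e₀)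

    path-along : ∀ {a b x y} → Linked e₀ a → Linked a b → 0 < inc G a x → 0 < inc G b y → Path G SE x y
    path-along {a} e₀~a ε x∈a y∈a = step a (linked⇒∈SE e₀~a) x∈a y∈a here
    path-along {a} e₀~a (a-c ◅ c~b) x∈a y∈b with SC.fold Adjacent-sym id a-c
    ... | v , _ , v∈a , v∈c = step a (linked⇒∈SE e₀~a) x∈a v∈a (path-along (e₀~a ◅◅ a-c ◅ ε) c~b v∈c y∈b)

    path-from-α : ∀ {v} → v ∈ SV → Path G SE α v
    path-from-α v∈ with ∈-subsetOf⁻ _ v∈
    ... | inj₁ refl               = here
    ... | inj₂ (e , e₀~e , v∈e) = path-along ε e₀~e α∈e₀ v∈e

    module _ {SVI SVJ : Subset m} {SEI SEJ : Subset (nE G)}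
             (sub-I : IsSub G (SVI , SEI)) (sub-J : IsSub G (SVJ , SEJ))
             (∩-V : SVI ∩ SVJ ≡ ⁅ α ⁆) (∪-E : SEI ∪ SEJ ≡ SE) where

      stays-in-I : ∀ {a b} → Linked e₀ a → Linked a b → a ∈ SEI → b ∈ SEI
      stays-in-I e₀~a ε a∈I = a∈I
      stays-in-I {a} e₀~a (_◅_ {j = c} a-c c~b) a∈I
        with x∈p∪q⁻ SEI SEJ (subst (c ∈_) (sym ∪-E) (linked⇒∈SE (e₀~a ◅◅ a-c ◅ ε)))
      ... | inj₁ c∈I = stays-in-I (e₀~a ◅◅ a-c ◅ ε) c~b c∈I
      ... | inj₂ c∈J with SC.fold Adjacent-sym id a-c
      ...   | v , v≢α , v∈a , v∈c =
                contradiction (x∈⁅y⁆⇒x≡y α (subst (v ∈_) ∩-V (x∈p∩q⁺ (sub-I a v a∈I v∈a , sub-J c v c∈J v∈c)))) v≢α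

      no-split : SEI ∩ SEJ ≡ ∅ → NonTrivial G (SVJ , SEJ) → e₀ ∉ SEI
      no-split ∩-E (x , x∈J) e₀∈I = ∉⊥ (subst (x ∈_) ∩-E (x∈p∩q⁺ (x∈I , x∈J)))
        where
        x∈I : x ∈ SEI
        x∈I = stays-in-I ε (∈SE⇒linked (subst (x ∈_) ∪-E (x∈p∪q⁺ (inj₂ x∈J)))) e₀∈I

    isWing : IsWing G α (SV , SE)
    isWing = ∈-subsetOf⁺ _ (inj₁ refl) , sub , (e₀ , linked⇒∈SE ε) , connected , not-cut , closed
      where
      sub : IsSub G (SV , SE)
      sub e v e∈ v∈e = ∈-subsetOf⁺ _ (inj₂ (e , ∈SE⇒linked e∈ , v∈e))

      connected : ConnectedSub G (SV , SE)
      connected u v u∈ v∈ = Path-trans (Path-sym (path-from-α u∈)) (path-from-α v∈)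

      not-cut : ¬ CutVertex G (SV , SE) α
      not-cut ((SVI , SEI) , (SVJ , SEJ) , sub-I , sub-J , ne-I , ne-J , _ , ∪-E , ∩-V , ∩-E)
        with x∈p∪q⁻ SEI SEJ (subst (e₀ ∈_) (sym ∪-E) (linked⇒∈SE ε))
      ... | inj₁ e₀∈I = no-split sub-I sub-J ∩-V ∪-E ∩-E ne-J e₀∈I
      ... | inj₂ e₀∈J = no-split sub-J sub-I (trans (∩-comm SVJ SVI) ∩-V) (trans (∪-comm SEJ SEI) ∪-E)
                                 (trans (∩-comm SEJ SEI) ∩-E) ne-I e₀∈J

      closed : ∀ e v → e ∉ SE → v ∈ SV → v ≢ α → inc G e v ≡ 0
      closed e v e∉ v∈ v≢α with ∈-subsetOf⁻ _ v∈
      ... | inj₁ v≡α               = contradiction v≡α v≢α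
      ... | inj₂ (f , e₀~f , v∈f) with inc G e v in eq
      ...   | zero  = refl
      ...   | suc _ = contradiction (linked⇒∈SE (e₀~f ◅◅ fwd (v , v≢α , v∈f , subst (0 <_) (sym eq) z<s) ◅ ε)) e∉

  wing-through : ∀ e₀ → 0 < inc G e₀ α → ∃ λ W → IsWing G α W × e₀ ∈ proj₂ W
  wing-through e₀ α∈e₀ = (SV , SE) , isWing , linked⇒∈SE ε
    where open WingThrough e₀ α∈e₀

-- Detachments

data Split (m n : ℕ) : Fin (m + n) → Set where
  left  : ∀ i → Split m n (i ↑ˡ n)
  right : ∀ j → Split m n (m ↑ʳ j)

split : ∀ m n v → Split m n v
split m n v with splitAt m {n} v in eq
... | inj₁ i = subst (Split m n) (splitAt⁻¹-↑ˡ eq) (left i)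
... | inj₂ j = subst (Split m n) (splitAt⁻¹-↑ʳ eq) (right j)

↑ˡ≢↑ʳ : ∀ {m n} (i : Fin m) (j : Fin n) → i ↑ˡ n ≢ m ↑ʳ j
↑ˡ≢↑ʳ {m} {n} i j eq with trans (sym (splitAt-↑ˡ m i n)) (trans (cong (splitAt m) eq) (splitAt-↑ʳ m n j))
... | ()

module Detachment {m : ℕ} {G : Hypergraph (suc m)} {α : Fin (suc m)} {n : ℕ} {F : Hypergraph (m + n)}
                  (D : IsDetachment G α n F) where

  σ : Fin (nE G) → Fin (nE F)
  σ = Bijection.to (proj₁ D)

  inc-old : ∀ e i → inc F (σ e) (i ↑ˡ n) ≡ inc G e (punchIn α i)
  inc-old = proj₁ (proj₂ D)

  inc-new : ∀ e → sumFin (λ j → inc F (σ e) (m ↑ʳ j)) ≡ inc G e α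
  inc-new = proj₂ (proj₂ D)

  new∈⇒α∈ : ∀ {e} j → 0 < inc F (σ e) (m ↑ʳ j) → 0 < inc G e α
  new∈⇒α∈ {e} j αⱼ∈e =
    <-≤-trans αⱼ∈e (subst (inc F (σ e) (m ↑ʳ j) ≤_) (inc-new e) (≤-sumFin (λ j → inc F (σ e) (m ↑ʳ j)) j))

  α∈⇒new∈ : ∀ {e} → 0 < inc G e α → ∃ λ j → 0 < inc F (σ e) (m ↑ʳ j)
  α∈⇒new∈ {e} α∈e = sumFin-positive _ (subst (0 <_) (sym (inc-new e)) α∈e)

  project : Fin (m + n) → Fin (suc m)
  project v = [ punchIn α , const α ]′ (splitAt m v)

  project-old : ∀ i → project (i ↑ˡ n) ≡ punchIn α i
  project-old i rewrite splitAt-↑ˡ m i n = refl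

  project-new : ∀ j → project (m ↑ʳ j) ≡ α
  project-new j rewrite splitAt-↑ʳ m n j = refl

  project-surjective : 1 ≤ n → StrictlySurjective _≡_ project
  project-surjective 1≤n w with w ≟ α
  project-surjective (s≤s z≤n) w | yes refl = m ↑ʳ zero , project-new zero
  ... | no w≢α = punchOut (w≢α ∘ sym) ↑ˡ n , trans (project-old _) (punchIn-punchOut _)

  project-∈ : ∀ {e v} → 0 < inc F (σ e) v → 0 < inc G e (project v)
  project-∈ {e} {v} v∈e with split m n v
  ... | left i  = subst (0 <_) (trans (inc-old e i) (cong (inc G e) (sym (project-old i)))) v∈e
  ... | right j = subst (λ w → 0 < inc G e w) (sym (project-new j)) (new∈⇒α∈ j v∈e)

  σ⁻¹ : Fin (nE F) → Fin (nE G)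
  σ⁻¹ = Surjection.to⁻ (Bijection.surjection (proj₁ D))

  σ∘σ⁻¹ : ∀ f → σ (σ⁻¹ f) ≡ f
  σ∘σ⁻¹ = Surjection.to∘to⁻ (Bijection.surjection (proj₁ D))

  ∈σ∘σ⁻¹ : ∀ {f v} → 0 < inc F f v → 0 < inc F (σ (σ⁻¹ f)) v
  ∈σ∘σ⁻¹ {f} {v} = subst (λ g → 0 < inc F g v) (sym (σ∘σ⁻¹ f))

  project-Path : ∀ {u v} → Path F ⊤ u v → Path G ⊤ (project u) (project v)
  project-Path here                   = here
  project-Path (step f _ u∈f w∈f p) =
    step (σ⁻¹ f) ∈⊤ (project-∈ (∈σ∘σ⁻¹ u∈f)) (project-∈ (∈σ∘σ⁻¹ w∈f)) (project-Path p)

  -- Projection induces a surjection from the components of F onto those of G;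
  -- having the same finite number of components, it is injective.
  new-vertices-connected : 1 ≤ n → ∀ {k} → Components G k → Components F k →
                           ∀ i j → Path F ⊤ (m ↑ʳ i) (m ↑ʳ j)
  new-vertices-connected 1≤n {k} (compG , compG-onto , _ , compG-resp) (compF , compF-onto , compF-sound , _)
                         i j =
    compF-sound _ _ (surjective⇒injective induced induced-surjective induced-αᵢ≡αⱼ)
    where
    induced : Fin k → Fin k
    induced c = compG (project (proj₁ (compF-onto c)))

    induced-compF : ∀ u → induced (compF u) ≡ compG (project u)
    induced-compF u = compG-resp _ _ (project-Path (compF-sound _ _ (proj₂ (compF-onto (compF u)))))

    induced-surjective : StrictlySurjective _≡_ induced
    induced-surjective c with compG-onto c
    ... | w , w↦c with project-surjective 1≤n w
    ... | u , u↦w = compF u , trans (induced-compF u) (trans (cong compG u↦w) w↦c)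

    induced-αᵢ≡αⱼ : induced (compF (m ↑ʳ i)) ≡ induced (compF (m ↑ʳ j))
    induced-αᵢ≡αⱼ = trans (induced-compF _)
                     (trans (cong compG (trans (project-new i) (sym (project-new j)))) (sym (induced-compF _)))

-- The graph B of the header: node j ↑ˡ ω is the new vertex αⱼ, node n ↑ʳ i the i-th wing.
module WingGraph {m} {G : Hypergraph (suc m)} {α : Fin (suc m)} {n} {F : Hypergraph (m + n)}
                 (D : IsDetachment G α n F) {ws : List (SubH G)} (ws-unique : Unique ws)
                 (ws-wings : All (IsWing G α) ws) (ws-complete : ∀ W → IsWing G α W → W List.∈ ws) where

  open Detachment {G = G} {α} {n} {F} D

  ω : ℕ
  ω = length ws

  wing : Fin ω → SubH G
  wing = lookup ws

  wing-isWing : ∀ i → IsWing G α (wing i)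
  wing-isWing i = All.lookup ws-wings (∈-lookup i)

  wing-containing : ∀ e → 0 < inc G e α → ∃ λ i → e ∈ proj₂ (wing i)
  wing-containing e α∈e with wing-through e α∈e
  ... | W , W-wing , e∈W = Any.index W∈ws , subst (λ V → e ∈ proj₂ V) (lookup-index W∈ws) e∈W
    where W∈ws = ws-complete W W-wing

  wing-containing-unique : ∀ {e i} (α∈e : 0 < inc G e α) → e ∈ proj₂ (wing i) →
                           proj₁ (wing-containing e α∈e) ≡ i
  wing-containing-unique {e} α∈e e∈ = Unique-lookup-injective ws-unique
    (wings-sharing-edge-≡ (wing-isWing _) (wing-isWing _) (proj₂ (wing-containing e α∈e)) e∈)

  Node : Set
  Node = Fin (n + ω)

  links : Fin (nE G) → Fin n → List (Node × Node)
  links e j with 0 <? inc F (σ e) (m ↑ʳ j)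
  ... | yes αⱼ∈e = [ j ↑ˡ ω , n ↑ʳ proj₁ (wing-containing e (new∈⇒α∈ j αⱼ∈e)) ]
  ... | no  _    = []

  B : List (Node × Node)
  B = concatFin λ e → concatFin (links e)

  length-links : ∀ e j → length (links e j) ≤ inc F (σ e) (m ↑ʳ j)
  length-links e j with 0 <? inc F (σ e) (m ↑ʳ j)
  ... | yes αⱼ∈e = αⱼ∈e
  ... | no  _    = z≤n

  length-B : length B ≤ deg G α
  length-B = begin
    length B                                    ≡⟨ length-concatFin (λ e → concatFin (links e)) ⟩
    sumFin (λ e → length (concatFin (links e))) ≤⟨ sumFin-mono-≤ length-links-at ⟩
    sumFin (λ e → inc G e α)                    ∎
    where
    open ≤-Reasoning
    length-links-at : ∀ e → length (concatFin (links e)) ≤ inc G e α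
    length-links-at e = begin
      length (concatFin (links e))          ≡⟨ length-concatFin (links e) ⟩
      sumFin (length ∘ links e)             ≤⟨ sumFin-mono-≤ (length-links e) ⟩
      sumFin (λ j → inc F (σ e) (m ↑ʳ j)) ≡⟨ inc-new e ⟩
      inc G e α                             ∎

  link : ∀ {e i j} → e ∈ proj₂ (wing i) → 0 < inc F (σ e) (m ↑ʳ j) → Reach B (j ↑ˡ ω) (n ↑ʳ i)
  link {e} {i} {j} e∈ αⱼ∈e = fwd (∈-concatFin⁺ _ e (∈-concatFin⁺ (links e) j ∈links)) ◅ ε
    where
    ∈links : (j ↑ˡ ω , n ↑ʳ i) List.∈ links e j
    ∈links with 0 <? inc F (σ e) (m ↑ʳ j)
    ... | yes αⱼ∈e′ = here (cong (λ i′ → j ↑ˡ ω , n ↑ʳ i′) (sym (wing-containing-unique (new∈⇒α∈ j αⱼ∈e′) e∈)))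
    ... | no  αⱼ∉e  = contradiction αⱼ∈e αⱼ∉e

  data Represents (u : Fin (m + n)) : Node → Set where
    new : ∀ j → u ≡ m ↑ʳ j → Represents u (j ↑ˡ ω)
    old : ∀ x i → u ≡ x ↑ˡ n → punchIn α x ∈ proj₁ (wing i) → Represents u (n ↑ʳ i)

  within-wing : ∀ {e w i} → e ∈ proj₂ (wing i) → 0 < inc F (σ e) w →
                ∃ λ r → Represents w r × Reach B (n ↑ʳ i) r
  within-wing {e} {w} {i} e∈ w∈e with split m n w
  ... | left x  = n ↑ʳ i , old x i refl (wing-isSub (wing-isWing i) e _ e∈ (subst (0 <_) (inc-old e x) w∈e)) , ε
  ... | right j = j ↑ˡ ω , new j refl , symmetric _ (link e∈ w∈e)

  along-edge : ∀ {e u w r} → 0 < inc F (σ e) u → 0 < inc F (σ e) w → Represents u r →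
               ∃ λ r′ → Represents w r′ × Reach B r r′
  along-edge {e} {w = w} u∈e w∈e (new j refl) = through-wing (proj₂ (wing-containing e (new∈⇒α∈ j u∈e)))
    where
    through-wing : ∀ {i} → e ∈ proj₂ (wing i) → ∃ λ r′ → Represents w r′ × Reach B (j ↑ˡ ω) r′
    through-wing e∈ = Product.map₂ (Product.map₂ (link e∈ u∈e ◅◅_)) (within-wing e∈ w∈e)
  along-edge {e} u∈e w∈e (old x i refl x∈) with e ∈? proj₂ (wing i)
  ... | yes e∈ = within-wing e∈ w∈e
  ... | no  e∉ = ⊥-elim (n≮0 (subst (0 <_) x∉e u∈e))
    where
    x∉e : inc F (σ e) (x ↑ˡ n) ≡ 0
    x∉e = trans (inc-old e x) (wing-closed (wing-isWing i) e _ e∉ x∈ (punchInᵢ≢i α x))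

  reaches-new : ∀ {u j r} → Path F ⊤ u (m ↑ʳ j) → Represents u r → Reach B r (j ↑ˡ ω)
  reaches-new {j = j} here (new j′ eq) rewrite ↑ʳ-injective m j j′ eq = ε
  reaches-new {j = j} here (old x i eq _) = contradiction (sym eq) (↑ˡ≢↑ʳ x j)
  reaches-new (step f _ u∈f w∈f p) u↦r with along-edge (∈σ∘σ⁻¹ u∈f) (∈σ∘σ⁻¹ w∈f) u↦r
  ... | r′ , w↦r′ , r~r′ = r~r′ ◅◅ reaches-new p w↦r′

  module _ (1≤n : 1 ≤ n) {k} (G-components : Components G k) (F-components : Components F k) where

    new-reach : ∀ j j′ → Reach B (j ↑ˡ ω) (j′ ↑ˡ ω)
    new-reach j j′ = reaches-new (new-vertices-connected 1≤n G-components F-components j j′) (new j refl)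

    α₀ : Fin n
    α₀ = fromℕ< 1≤n

    reach-α₀ : ∀ x → Reach B x (α₀ ↑ˡ ω)
    reach-α₀ x with split n ω x
    ... | left j  = new-reach j α₀
    ... | right i with wing-edge-at-α (wing-isWing i)
    ...   | e , e∈ , α∈e with α∈⇒new∈ α∈e
    ...     | j , αⱼ∈e = symmetric _ (link e∈ αⱼ∈e) ◅◅ new-reach j α₀

    B-connected : ∀ x y → Reach B x y
    B-connected x y = reach-α₀ x ◅◅ symmetric _ (reach-α₀ y)

    n+ω≤1+deg : n + ω ≤ suc (deg G α)
    n+ω≤1+deg = ≤-trans (connected⇒≤1+length B B-connected) (s≤s length-B)

lemma3p5 : ∀ {m} (G : Hypergraph (suc m)) (α : Fin (suc m)) (n : ℕ) → 1 ≤ n →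
           (F : Hypergraph (m + n)) → IsDetachment G α n F →
           (∃ λ k → Components G k × Components F k) →
           (ω : ℕ) → WingCount G α ω →
           (n ∸ 1) + ω ≤ deg G α
lemma3p5 G α (suc n) 1≤n F D (k , G-components , F-components) _ (ws , ws-unique , ws-wings , ws-complete , refl) =
  s≤s⁻¹ (WingGraph.n+ω≤1+deg D ws-unique ws-wings ws-complete 1≤n G-components F-components)
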